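{- Let $G$ be a connected graph on $n$ vertices with distance matrix $D$. Assume either that there exists a curvature potential $\vec x\in\mathbb{R}^n$ of $G$ with $\vec 1^\top\vec x\neq 0$, or that $G$ is distance exceptional. Then the affine space $$X(G):=\{D\vec x:\ \vec x\in\mathbb{R}^n,\ \vec x^\top\vec 1=1\}$$ intersects the line $\mathbb{R}\vec 1$ in exactly one point.
   Context: For a connected graph $G$ with vertices $v_1,\dots,v_n$, $D=(d(v_i,v_j))_{i,j}$ is its shortest-path distance matrix and $\vec 1$ the all-ones vector. A curvature potential of $G$ is a vector $\vec x\in\mathbb{R}^n$ with $D\vec x=\vec 1$. $G$ is distance exceptional if $D\vec x=\vec 1$ has no solution (i.e. $G$ has no curvature potential).
   Formalization: Curvature potentials, the vectors $\vec x$ defining $X(G)$, and the points of $X(G)$ and of the line $\mathbb{R}\vec 1$ have rational coordinates, so distance exceptional means having no rational curvature potential. -}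

module Defs where

open import Data.Nat using (ℕ; zero; suc; _≤_)
open import Data.Fin using (Fin; zero; suc)
open import Data.Bool using (Bool; true)
open import Data.Product using (Σ; _×_; ∃; ∃-syntax)
open import Data.Integer using (+_)
open import Data.Rational using (ℚ; 0ℚ; 1ℚ; _+_; _*_)
open import Relation.Binary.PropositionalEquality using (_≡_)
open import Relation.Nullary using (¬_)

record Graph (n : ℕ) : Set where
  field
    adj     : Fin n → Fin n → Bool
    symm    : ∀ u v → adj u v ≡ adj v u
    loopless : ∀ u → ¬ (adj u u ≡ true)
open Graph public

data Walk {n : ℕ} (G : Graph n) : Fin n → Fin n → ℕ → Set where
  nil  : ∀ {u} → Walk G u u 0
  cons : ∀ {u w v k} → adj G u w ≡ true → Walk G w v k → Walk G u v (suc k)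

Connected : ∀ {n} → Graph n → Set
Connected {n} G = ∀ (u v : Fin n) → ∃[ k ] Walk G u v k

IsDistanceMatrix : ∀ {n} → Graph n → (Fin n → Fin n → ℕ) → Set
IsDistanceMatrix {n} G D =
  ∀ (u v : Fin n) → Walk G u v (D u v) × (∀ k → Walk G u v k → D u v ≤ k)

sumℚ : ∀ {n} → (Fin n → ℚ) → ℚ
sumℚ {zero}  f = 0ℚ
sumℚ {suc n} f = f zero + sumℚ (λ i → f (suc i))

mulVec : ∀ {n} → (Fin n → Fin n → ℕ) → (Fin n → ℚ) → (Fin n → ℚ)
mulVec D x i = sumℚ (λ j → Data.Rational._/_ (+ D i j) 1 * x j)

IsCurvaturePotential : ∀ {n} → (Fin n → Fin n → ℕ) → (Fin n → ℚ) → Set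
IsCurvaturePotential D x = ∀ i → mulVec D x i ≡ 1ℚ

DistanceExceptional : ∀ {n} → (Fin n → Fin n → ℕ) → Set
DistanceExceptional {n} D = ¬ (Σ (Fin n → ℚ) (IsCurvaturePotential D))

InX : ∀ {n} → (Fin n → Fin n → ℕ) → (Fin n → ℚ) → Set
InX {n} D y = Σ (Fin n → ℚ) λ x → (sumℚ x ≡ 1ℚ) × (∀ i → mulVec D x i ≡ y i)

-- The line ℝ·1 (here ℚ·1).
OnLine : ∀ {n} → (Fin n → ℚ) → Set
OnLine {n} y = ∃[ t ] (∀ (i : Fin n) → y i ≡ t)

{-# OPTIONS --safe #-}
-- If D x = 𝟙 and 𝟙ᵀx = s ≠ 0, then x/s lies in X(G) and D(x/s) = 𝟙/s; conversely, if
-- 𝟙ᵀu = 1 and D u = t𝟙, then s t = xᵀD u = uᵀD x = 𝟙ᵀu = 1 by symmetry of D.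
-- If G is distance exceptional, 𝟙 is not in the column space of D, so Gaussian elimination
-- (the Fredholm alternative over ℚ) yields w with wᵀD = 0 and wᵀ𝟙 = 1. By symmetry D w = 0,
-- so 0 ∈ X(G); and t𝟙 ∈ X(G) with t ≠ 0 would rescale to a curvature potential.
module Submission where

open import Defs
open import Data.Bool using (true)
open import Data.Nat using (ℕ; zero; suc)
open import Data.Empty using (⊥-elim)
open import Data.Fin using (Fin; zero; suc)
open import Data.Fin.Properties using (all?; ¬∀⟶∃¬)
import Data.Integer as ℤ
open import Data.Product using (Σ; _×_; ∃-syntax; _,_; proj₁; proj₂)
open import Data.Sum using (_⊎_; inj₁; inj₂)
import Data.Sum as Sum
open import Data.Vec.Functional using (Vector; _∷_)
open import Data.Rational using (ℚ; 0ℚ; 1ℚ; _+_; _*_; -_; _-_; _/_; 1/_; NonZero; ≢-nonZero)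
open import Data.Rational.Properties
  using (_≟_; +-*-commutativeRing; *-comm; *-zeroʳ; *-identityʳ; *-inverseˡ)
open import Data.Rational.Solver using (module +-*-Solver)
open import Algebra.Bundles using (CommutativeRing)
open import Algebra.Properties.Semiring.Sum (CommutativeRing.semiring +-*-commutativeRing)
  using (sum; sum-cong-≗; sum-replicate-zero; ∑-distrib-+; ∑-comm; *-distribˡ-sum; *-distribʳ-sum)
open import Relation.Nullary using (yes; no)
open import Relation.Binary.PropositionalEquality
  using (_≡_; _≢_; refl; sym; trans; cong; module ≡-Reasoning)
import Data.Nat.Properties as ℕ

open +-*-Solver
open ≡-Reasoning

sumℚ≡sum : ∀ {n} (f : Vector ℚ n) → sumℚ f ≡ sum f
sumℚ≡sum {zero}  f = refl
sumℚ≡sum {suc n} f = cong (f zero +_) (sumℚ≡sum (λ i → f (suc i)))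

∑-sub-scaled : ∀ {n} (f g : Vector ℚ n) (c : ℚ) →
               sum (λ i → f i - c * g i) ≡ sum f - c * sum g
∑-sub-scaled {n} f g c = begin
  sum (λ i → f i - c * g i)
    ≡⟨ sum-cong-≗ {n} (λ i → solve 3 (λ f c g → f :- c :* g := f :+ (:- c) :* g) refl (f i) c (g i)) ⟩
  sum (λ i → f i + (- c) * g i)
    ≡⟨ ∑-distrib-+ f _ ⟩
  sum f + sum (λ i → (- c) * g i)
    ≡⟨ cong (sum f +_) (sym (*-distribˡ-sum (- c) g)) ⟩
  sum f + (- c) * sum g
    ≡⟨ solve 3 (λ s c t → s :+ (:- c) :* t := s :- c :* t) refl (sum f) c (sum g) ⟩
  sum f - c * sum g
    ∎

inverse-unique : ∀ s t .{{_ : NonZero s}} → s * t ≡ 1ℚ → t ≡ 1/ s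
inverse-unique s t st≡1 = begin
  t                ≡⟨ solve 1 (λ t → t := con 1ℚ :* t) refl t ⟩
  1ℚ * t           ≡⟨ cong (_* t) (sym (*-inverseˡ s)) ⟩
  (1/ s * s) * t   ≡⟨ solve 3 (λ i s t → (i :* s) :* t := i :* (s :* t)) refl (1/ s) s t ⟩
  1/ s * (s * t)   ≡⟨ cong (1/ s *_) st≡1 ⟩
  1/ s * 1ℚ        ≡⟨ *-identityʳ (1/ s) ⟩
  1/ s             ∎

infix 7 _·_

_·_ : ∀ {n} → Vector ℚ n → Vector ℚ n → ℚ
u · v = sum (λ i → u i * v i)

·-comm : ∀ {n} (u v : Vector ℚ n) → u · v ≡ v · u
·-comm {n} u v = sum-cong-≗ {n} (λ i → *-comm (u i) (v i))

·-constʳ : ∀ {n} (u : Vector ℚ n) (c : ℚ) → u · (λ _ → c) ≡ sum u * c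
·-constʳ {n} u c = sym (*-distribʳ-sum c u)

·-zeroʳ : ∀ {n} (u v : Vector ℚ n) → (∀ i → v i ≡ 0ℚ) → u · v ≡ 0ℚ
·-zeroʳ {n} u v v≡0 = begin
  u · v              ≡⟨ sum-cong-≗ {n} (λ i → trans (cong (u i *_) (v≡0 i)) (*-zeroʳ (u i))) ⟩
  sum {n} (λ _ → 0ℚ) ≡⟨ sum-replicate-zero n ⟩
  0ℚ                 ∎

·-scaleˡ : ∀ {n} (c : ℚ) (u v : Vector ℚ n) → (λ i → c * u i) · v ≡ c * (u · v)
·-scaleˡ {n} c u v = begin
  (λ i → c * u i) · v
    ≡⟨ sum-cong-≗ {n} (λ i → solve 3 (λ c u v → (c :* u) :* v := c :* (u :* v)) refl c (u i) (v i)) ⟩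
  sum (λ i → c * (u i * v i)) ≡⟨ sym (*-distribˡ-sum {n} c _) ⟩
  c * (u · v)                 ∎

·-scaleʳ : ∀ {n} (c : ℚ) (u v : Vector ℚ n) → u · (λ i → c * v i) ≡ c * (u · v)
·-scaleʳ {n} c u v = begin
  u · (λ i → c * v i)
    ≡⟨ sum-cong-≗ {n} (λ i → solve 3 (λ c u v → u :* (c :* v) := c :* (u :* v)) refl c (u i) (v i)) ⟩
  sum (λ i → c * (u i * v i)) ≡⟨ sym (*-distribˡ-sum {n} c _) ⟩
  c * (u · v)                 ∎

·-sub-scaledˡ : ∀ {n} (u v x : Vector ℚ n) (c : ℚ) →
                (λ i → u i - c * v i) · x ≡ u · x - c * (v · x)
·-sub-scaledˡ {n} u v x c = begin
  (λ i → u i - c * v i) · x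
    ≡⟨ sum-cong-≗ {n} (λ i → solve 4 (λ u c v x → (u :- c :* v) :* x := u :* x :- c :* (v :* x))
                                      refl (u i) c (v i) (x i)) ⟩
  sum (λ i → u i * x i - c * (v i * x i))
    ≡⟨ ∑-sub-scaled (λ i → u i * x i) (λ i → v i * x i) c ⟩
  u · x - c * (v · x)
    ∎

·-sub-scaledʳ : ∀ {n} (w u r : Vector ℚ n) (k : ℚ) →
                w · (λ i → u i - r i * k) ≡ w · u - (w · r) * k
·-sub-scaledʳ {n} w u r k = begin
  w · (λ i → u i - r i * k)
    ≡⟨ sum-cong-≗ {n} (λ i → solve 4 (λ w u r k → w :* (u :- r :* k) := w :* u :- k :* (w :* r))
                                      refl (w i) (u i) (r i) k) ⟩
  sum (λ i → w i * u i - k * (w i * r i))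
    ≡⟨ ∑-sub-scaled (λ i → w i * u i) (λ i → w i * r i) k ⟩
  w · u - k * (w · r)
    ≡⟨ cong (λ z → w · u - z) (*-comm k (w · r)) ⟩
  w · u - (w · r) * k
    ∎

basis : ∀ {n} → Fin n → Vector ℚ n
basis zero    zero    = 1ℚ
basis zero    (suc _) = 0ℚ
basis (suc _) zero    = 0ℚ
basis (suc p) (suc i) = basis p i

·-basisˡ : ∀ {n} (p : Fin n) (v : Vector ℚ n) → basis p · v ≡ v p
·-basisˡ {suc n} zero v = begin
  1ℚ * v zero + sum {n} (λ i → 0ℚ * v (suc i))
    ≡⟨ cong (1ℚ * v zero +_) (sym (*-distribˡ-sum {n} 0ℚ _)) ⟩
  1ℚ * v zero + 0ℚ * Σv′
    ≡⟨ solve 2 (λ x s → con 1ℚ :* x :+ con 0ℚ :* s := x) refl (v zero) Σv′ ⟩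
  v zero
    ∎
  where Σv′ = sum {n} (λ i → v (suc i))
·-basisˡ (suc p) v = begin
  0ℚ * v zero + basis p · (λ i → v (suc i))
    ≡⟨ cong (0ℚ * v zero +_) (·-basisˡ p _) ⟩
  0ℚ * v zero + v (suc p)
    ≡⟨ solve 2 (λ x y → con 0ℚ :* x :+ y := y) refl (v zero) (v (suc p)) ⟩
  v (suc p)
    ∎

·-sub-basisˡ : ∀ {n} (w : Vector ℚ n) (c : ℚ) (p : Fin n) (v : Vector ℚ n) →
               (λ i → w i - c * basis p i) · v ≡ w · v - c * v p
·-sub-basisˡ w c p v = trans (·-sub-scaledˡ w (basis p) v c) (cong (λ z → w · v - c * z) (·-basisˡ p v))

Matrix : ℕ → ℕ → Set
Matrix m n = Fin m → Fin n → ℚ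

Solution : ∀ {m n} → Matrix m n → Vector ℚ m → Set
Solution {n = n} A b = Σ (Vector ℚ n) λ x → ∀ i → A i · x ≡ b i

Obstruction : ∀ {m n} → Matrix m n → Vector ℚ m → Set
Obstruction {m} A b = Σ (Vector ℚ m) λ w → (∀ j → w · (λ i → A i j) ≡ 0ℚ) × w · b ≡ 1ℚ

zero-or-nonzero-entry : ∀ {m} (a : Vector ℚ m) → (∀ i → a i ≡ 0ℚ) ⊎ ∃[ p ] a p ≢ 0ℚ
zero-or-nonzero-entry {m} a with all? (λ i → a i ≟ 0ℚ)
... | yes a≡0 = inj₁ a≡0
... | no  a≢0 = inj₂ (¬∀⟶∃¬ m _ (λ i → a i ≟ 0ℚ) a≢0)

no-columns-alternative : ∀ {m} (A : Matrix m 0) (b : Vector ℚ m) → Solution A b ⊎ Obstruction A b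
no-columns-alternative A b with zero-or-nonzero-entry b
... | inj₁ b≡0         = inj₁ ((λ ()) , λ i → sym (b≡0 i))
... | inj₂ (p , bp≢0) = inj₂ ((λ i → 1/ b p * basis p i) , (λ ()) , w·b≡1)
  where
  instance _ = ≢-nonZero bp≢0
  w·b≡1 : (λ i → 1/ b p * basis p i) · b ≡ 1ℚ
  w·b≡1 = begin
    (λ i → 1/ b p * basis p i) · b ≡⟨ ·-scaleˡ (1/ b p) (basis p) b ⟩
    1/ b p * (basis p · b)         ≡⟨ cong (1/ b p *_) (·-basisˡ p b) ⟩
    1/ b p * b p                   ≡⟨ *-inverseˡ (b p) ⟩
    1ℚ                             ∎

module ZeroFirstColumn {m n} (A : Matrix m (suc n)) (b : Vector ℚ m)
                       (first≡0 : ∀ i → A i zero ≡ 0ℚ) where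

  A⁻ : Matrix m n
  A⁻ i j = A i (suc j)

  lift-solution : Solution A⁻ b → Solution A b
  lift-solution (x , A⁻x≡b) = 0ℚ ∷ x , λ i → begin
    A i zero * 0ℚ + A⁻ i · x ≡⟨ solve 2 (λ a s → a :* con 0ℚ :+ s := s) refl (A i zero) (A⁻ i · x) ⟩
    A⁻ i · x                 ≡⟨ A⁻x≡b i ⟩
    b i                      ∎

  lift-obstruction : Obstruction A⁻ b → Obstruction A b
  lift-obstruction (w , w⊥A⁻ , w·b≡1) = w , w⊥A , w·b≡1
    where
    w⊥A : ∀ j → w · (λ i → A i j) ≡ 0ℚ
    w⊥A zero    = ·-zeroʳ w _ first≡0
    w⊥A (suc j) = w⊥A⁻ j

module EliminateFirstColumn {m n} (A : Matrix m (suc n)) (b : Vector ℚ m)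
                            (p : Fin m) (pivot≢0 : A p zero ≢ 0ℚ) where

  private instance _ = ≢-nonZero pivot≢0

  a : Vector ℚ m
  a i = A i zero

  r : Vector ℚ m
  r i = 1/ a p * a i

  A′ : Matrix m n
  A′ i j = A i (suc j) - r i * A p (suc j)

  b′ : Vector ℚ m
  b′ i = b i - r i * b p

  lift-solution : Solution A′ b′ → Solution A b
  lift-solution (x , A′x≡b′) = x₀ ∷ x , row
    where
    S : Vector ℚ m
    S i = (λ j → A i (suc j)) · x

    x₀ : ℚ
    x₀ = 1/ a p * (b p - S p)

    eliminated : ∀ i → S i - r i * S p ≡ b i - r i * b p
    eliminated i = trans (sym (·-sub-scaledˡ (λ j → A i (suc j)) (λ j → A p (suc j)) x (r i))) (A′x≡b′ i)

    row : ∀ i → A i · (x₀ ∷ x) ≡ b i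
    row i = begin
      a i * x₀ + S i
        ≡⟨ solve 5 (λ a a⁻¹ bp Sp Si → a :* (a⁻¹ :* (bp :- Sp)) :+ Si
                                      := (Si :- (a⁻¹ :* a) :* Sp) :+ (a⁻¹ :* a) :* bp)
                   refl (a i) (1/ a p) (b p) (S p) (S i) ⟩
      (S i - r i * S p) + r i * b p ≡⟨ cong (_+ r i * b p) (eliminated i) ⟩
      (b i - r i * b p) + r i * b p ≡⟨ solve 2 (λ bi c → (bi :- c) :+ c := bi) refl (b i) (r i * b p) ⟩
      b i                           ∎

  lift-obstruction : Obstruction A′ b′ → Obstruction A b
  lift-obstruction (w , w⊥A′ , w·b′≡1) = w′ , w′⊥A , w′·b≡1
    where
    -- A′ and b′ subtract r times row p, so shifting w by w · r at coordinate p makes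
    -- w′ see the remaining columns of A and b as w sees A′ and b′; the first column
    -- is annihilated too because r is that column scaled by 1/ a p.
    w′ : Vector ℚ m
    w′ i = w i - (w · r) * basis p i

    w′⊥A : ∀ j → w′ · (λ i → A i j) ≡ 0ℚ
    w′⊥A zero = begin
      w′ · a                           ≡⟨ ·-sub-basisˡ w (w · r) p a ⟩
      w · a - (w · r) * a p            ≡⟨ cong (λ z → w · a - z * a p) (·-scaleʳ (1/ a p) w a) ⟩
      w · a - (1/ a p * (w · a)) * a p ≡⟨ solve 3 (λ s i q → s :- (i :* s) :* q := s :- s :* (i :* q))
                                                  refl (w · a) (1/ a p) (a p) ⟩
      w · a - (w · a) * (1/ a p * a p) ≡⟨ cong (λ z → w · a - (w · a) * z) (*-inverseˡ (a p)) ⟩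
      w · a - (w · a) * 1ℚ             ≡⟨ solve 1 (λ s → s :- s :* con 1ℚ := con 0ℚ) refl (w · a) ⟩
      0ℚ                               ∎
    w′⊥A (suc j) = begin
      w′ · (λ i → A i (suc j))                        ≡⟨ ·-sub-basisˡ w (w · r) p _ ⟩
      w · (λ i → A i (suc j)) - (w · r) * A p (suc j) ≡⟨ sym (·-sub-scaledʳ w _ r (A p (suc j))) ⟩
      w · (λ i → A′ i j)                              ≡⟨ w⊥A′ j ⟩
      0ℚ                                              ∎

    w′·b≡1 : w′ · b ≡ 1ℚ
    w′·b≡1 = begin
      w′ · b                   ≡⟨ ·-sub-basisˡ w (w · r) p b ⟩
      w · b - (w · r) * b p    ≡⟨ sym (·-sub-scaledʳ w b r (b p)) ⟩
      w · b′                   ≡⟨ w·b′≡1 ⟩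
      1ℚ                       ∎

fredholm-alternative : ∀ {m} n (A : Matrix m n) (b : Vector ℚ m) → Solution A b ⊎ Obstruction A b
fredholm-alternative zero    A b = no-columns-alternative A b
fredholm-alternative (suc n) A b with zero-or-nonzero-entry (λ i → A i zero)
... | inj₁ first≡0 = Sum.map lift-solution lift-obstruction (fredholm-alternative n A⁻ b)
  where open ZeroFirstColumn A b first≡0
... | inj₂ (p , pivot≢0) = Sum.map lift-solution lift-obstruction (fredholm-alternative n A′ b′)
  where open EliminateFirstColumn A b p pivot≢0

symmetric⇒self-adjoint : ∀ {n} (M : Matrix n n) → (∀ i j → M i j ≡ M j i) →
                         ∀ x u → x · (λ i → M i · u) ≡ u · (λ j → M j · x)
symmetric⇒self-adjoint {n} M M-sym x u = begin
  x · (λ i → M i · u)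
    ≡⟨ sum-cong-≗ {n} (λ i → *-distribˡ-sum {n} (x i) _) ⟩
  sum (λ i → sum (λ j → x i * (M i j * u j)))
    ≡⟨ ∑-comm {n} {n} (λ i j → x i * (M i j * u j)) ⟩
  sum (λ j → sum (λ i → x i * (M i j * u j)))
    ≡⟨ sum-cong-≗ {n} (λ j → sum-cong-≗ {n} (λ i → swap i j)) ⟩
  sum (λ j → sum (λ i → u j * (M j i * x i)))
    ≡⟨ sum-cong-≗ {n} (λ j → sym (*-distribˡ-sum {n} (u j) _)) ⟩
  u · (λ j → M j · x)
    ∎
  where
  swap : ∀ i j → x i * (M i j * u j) ≡ u j * (M j i * x i)
  swap i j = trans (cong (λ m → x i * (m * u j)) (M-sym i j))
                   (solve 3 (λ x m u → x :* (m :* u) := u :* (m :* x)) refl (x i) (M j i) (u j))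

_∷ʳ_ : ∀ {n} {G : Graph n} {u w v k} → Walk G u w k → adj G w v ≡ true → Walk G u v (suc k)
nil       ∷ʳ e = cons e nil
cons e′ p ∷ʳ e = cons e′ (p ∷ʳ e)

reverse : ∀ {n} {G : Graph n} {u v k} → Walk G u v k → Walk G v u k
reverse         nil                = nil
reverse {G = G} (cons {u} {w} e p) = reverse p ∷ʳ trans (symm G w u) e

distance-symmetric : ∀ {n} (G : Graph n) (D : Fin n → Fin n → ℕ) → IsDistanceMatrix G D →
                     ∀ u v → D u v ≡ D v u
distance-symmetric G D isDist u v = ℕ.≤-antisym
  (proj₂ (isDist u v) (D v u) (reverse (proj₁ (isDist v u))))
  (proj₂ (isDist v u) (D u v) (reverse (proj₁ (isDist u v))))

toℚ : ∀ {n} → (Fin n → Fin n → ℕ) → Matrix n n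
toℚ D i j = ℤ.+ D i j / 1

mulVec≡· : ∀ {n} (D : Fin n → Fin n → ℕ) (x : Vector ℚ n) i → mulVec D x i ≡ toℚ D i · x
mulVec≡· D x i = sumℚ≡sum (λ j → toℚ D i j * x j)

InX-resp-≗ : ∀ {n} (D : Fin n → Fin n → ℕ) {y z : Vector ℚ n} →
             InX D y → (∀ i → y i ≡ z i) → InX D z
InX-resp-≗ D (x , Σx≡1 , Dx≡y) y≗z = x , Σx≡1 , λ i → trans (Dx≡y i) (y≗z i)

MeetsLineExactlyAt : ∀ {n} → (Fin n → Fin n → ℕ) → ℚ → Set
MeetsLineExactlyAt D t = InX D (λ _ → t) × (∀ s → InX D (λ _ → s) → s ≡ t)

module _ {n} (D : Fin n → Fin n → ℕ) (D-sym : ∀ i j → D i j ≡ D j i) where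

  toℚ-sym : ∀ i j → toℚ D i j ≡ toℚ D j i
  toℚ-sym i j = cong (λ d → ℤ.+ d / 1) (D-sym i j)

  mulVec-scale : ∀ c x i → mulVec D (λ j → c * x j) i ≡ c * mulVec D x i
  mulVec-scale c x i = begin
    mulVec D (λ j → c * x j) i ≡⟨ mulVec≡· D _ i ⟩
    toℚ D i · (λ j → c * x j)  ≡⟨ ·-scaleʳ c (toℚ D i) x ⟩
    c * (toℚ D i · x)          ≡⟨ cong (c *_) (sym (mulVec≡· D x i)) ⟩
    c * mulVec D x i           ∎

  potential-pairing : ∀ {x u t} → IsCurvaturePotential D x → (∀ i → mulVec D u i ≡ t) →
                      sumℚ x * t ≡ sumℚ u
  potential-pairing {x} {u} {t} Dx≡1 Du≡t = begin
    sumℚ x * t              ≡⟨ cong (_* t) (sumℚ≡sum x) ⟩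
    sum x * t               ≡⟨ sym (·-constʳ x t) ⟩
    x · (λ _ → t)
      ≡⟨ sum-cong-≗ {n} (λ i → cong (x i *_) (trans (sym (Du≡t i)) (mulVec≡· D u i))) ⟩
    x · (λ i → toℚ D i · u) ≡⟨ symmetric⇒self-adjoint (toℚ D) toℚ-sym x u ⟩
    u · (λ j → toℚ D j · x)
      ≡⟨ sum-cong-≗ {n} (λ j → cong (u j *_) (trans (sym (mulVec≡· D x j)) (Dx≡1 j))) ⟩
    u · (λ _ → 1ℚ)          ≡⟨ ·-constʳ u 1ℚ ⟩
    sum u * 1ℚ              ≡⟨ *-identityʳ (sum u) ⟩
    sum u                   ≡⟨ sym (sumℚ≡sum u) ⟩
    sumℚ u                  ∎

  potential⇒meets-line : ∀ {x} → IsCurvaturePotential D x → (Σx≢0 : sumℚ x ≢ 0ℚ) →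
                         MeetsLineExactlyAt D ((1/ sumℚ x) {{≢-nonZero Σx≢0}})
  potential⇒meets-line {x} Dx≡1 Σx≢0 = (x′ , Σx′≡1 , Dx′≡t) , only-t
    where
    instance _ = ≢-nonZero Σx≢0

    x′ : Vector ℚ n
    x′ j = 1/ sumℚ x * x j

    Σx′≡1 : sumℚ x′ ≡ 1ℚ
    Σx′≡1 = begin
      sumℚ x′            ≡⟨ sumℚ≡sum x′ ⟩
      sum x′             ≡⟨ sym (*-distribˡ-sum {n} (1/ sumℚ x) x) ⟩
      1/ sumℚ x * sum x  ≡⟨ cong (1/ sumℚ x *_) (sym (sumℚ≡sum x)) ⟩
      1/ sumℚ x * sumℚ x ≡⟨ *-inverseˡ (sumℚ x) ⟩
      1ℚ                 ∎

    Dx′≡t : ∀ i → mulVec D x′ i ≡ 1/ sumℚ x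
    Dx′≡t i = begin
      mulVec D x′ i               ≡⟨ mulVec-scale (1/ sumℚ x) x i ⟩
      1/ sumℚ x * mulVec D x i    ≡⟨ cong (1/ sumℚ x *_) (Dx≡1 i) ⟩
      1/ sumℚ x * 1ℚ              ≡⟨ *-identityʳ (1/ sumℚ x) ⟩
      1/ sumℚ x                   ∎

    only-t : ∀ s → InX D (λ _ → s) → s ≡ 1/ sumℚ x
    only-t s (u , Σu≡1 , Du≡s) = inverse-unique (sumℚ x) s (trans (potential-pairing Dx≡1 Du≡s) Σu≡1)

  exceptional⇒meets-line-at-0 : DistanceExceptional D → MeetsLineExactlyAt D 0ℚ
  exceptional⇒meets-line-at-0 exceptional with fredholm-alternative n (toℚ D) (λ _ → 1ℚ)
  ... | inj₁ (x , Dx≡1)          = ⊥-elim (exceptional (x , λ i → trans (mulVec≡· D x i) (Dx≡1 i)))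
  ... | inj₂ (w , w⊥D , w·1≡1) = (w , Σw≡1 , Dw≡0) , only-0
    where
    Σw≡1 : sumℚ w ≡ 1ℚ
    Σw≡1 = begin
      sumℚ w         ≡⟨ sumℚ≡sum w ⟩
      sum w          ≡⟨ sym (*-identityʳ (sum w)) ⟩
      sum w * 1ℚ     ≡⟨ sym (·-constʳ w 1ℚ) ⟩
      w · (λ _ → 1ℚ) ≡⟨ w·1≡1 ⟩
      1ℚ             ∎

    Dw≡0 : ∀ i → mulVec D w i ≡ 0ℚ
    Dw≡0 i = begin
      mulVec D w i          ≡⟨ mulVec≡· D w i ⟩
      toℚ D i · w           ≡⟨ ·-comm (toℚ D i) w ⟩
      w · toℚ D i           ≡⟨ sum-cong-≗ {n} (λ j → cong (w j *_) (toℚ-sym i j)) ⟩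
      w · (λ j → toℚ D j i) ≡⟨ w⊥D i ⟩
      0ℚ                    ∎

    only-0 : ∀ s → InX D (λ _ → s) → s ≡ 0ℚ
    only-0 s (u , _ , Du≡s) with s ≟ 0ℚ
    ... | yes s≡0 = s≡0
    ... | no  s≢0 = ⊥-elim (exceptional ((λ j → 1/ s * u j) , D[u/s]≡1))
      where
      instance _ = ≢-nonZero s≢0
      D[u/s]≡1 : ∀ i → mulVec D (λ j → 1/ s * u j) i ≡ 1ℚ
      D[u/s]≡1 i = trans (mulVec-scale (1/ s) u i) (trans (cong (1/ s *_) (Du≡s i)) (*-inverseˡ s))

  meets-line-exactly-once : (∃[ x ] (IsCurvaturePotential D x × sumℚ x ≢ 0ℚ)) ⊎ DistanceExceptional D
                          → ∃[ t ] MeetsLineExactlyAt D t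
  meets-line-exactly-once (inj₁ (x , Dx≡1 , Σx≢0)) = _ , potential⇒meets-line Dx≡1 Σx≢0
  meets-line-exactly-once (inj₂ exceptional)       = 0ℚ , exceptional⇒meets-line-at-0 exceptional

proposition3p1 : ∀ (n : ℕ) (G : Graph n) (D : Fin n → Fin n → ℕ)
    → Connected G → IsDistanceMatrix G D
    → ((∃[ x ] (IsCurvaturePotential D x × sumℚ x ≢ 0ℚ)) ⊎ DistanceExceptional D)
    → ∃[ y ] ((InX D y × OnLine y)
        × (∀ z → InX D z → OnLine z → ∀ i → z i ≡ y i))
proposition3p1 n G D _ isDist hypothesis =
  let (t , t∈X , only-t) = meets-line-exactly-once D (distance-symmetric G D isDist) hypothesis
  in  (λ _ → t) , (t∈X , t , λ _ → refl) ,
      λ z z∈X (s , z≡s) i → trans (z≡s i) (only-t s (InX-resp-≗ D z∈X z≡s))
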